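{- Let $A$ be a pseudo-BCI algebra and let $d$ be a type I symmetric derivation on $A$. Then for all $x,y\in A$: (1) $d(1)=x\to d(x)=x\rightsquigarrow d(x)$; (2) $d(x)=d(x)\Cup_1 d(1)=d(x)\Cup_2 d(1)$. If moreover $d(1)=1$, then: (3) $x\le d(x)$; (4) $d(x)\in\mathrm{At}(A)$; (5) $d(x)=d(x)\Cup_1 y=d(x)\Cup_2 y$.
   Context: A pseudo-BCI algebra is a structure $(A,\to,\rightsquigarrow,1)$ of type $(2,2,0)$ such that for all $x,y,z\in A$: $(x\to y)\rightsquigarrow[(y\to z)\rightsquigarrow(x\to z)]=1$; $(x\rightsquigarrow y)\to[(y\rightsquigarrow z)\to(x\rightsquigarrow z)]=1$; $1\to x=x$; $1\rightsquigarrow x=x$; and $x\to y=1$, $y\to x=1$ imply $x=y$. Write $x\le y$ iff $x\to y=1$. $\mathrm{At}(A)$ is the set of atoms, i.e. elements $a$ such that $a\le x$ implies $x=a$. Put $x\Cup_1 y=(x\to y)\rightsquigarrow y$ and $x\Cup_2 y=(x\rightsquigarrow y)\to y$. A map $d:A\to A$ is a type I symmetric derivation if $d(x\to y)=(x\to d(y))\Cup_2(y\to d(x))$ and $d(x\rightsquigarrow y)=(x\rightsquigarrow d(y))\Cup_1(y\rightsquigarrow d(x))$ for all $x,y\in A$. -}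

module Defs where

open import Level using (Level; suc)
open import Relation.Binary.PropositionalEquality using (_≡_)
open import Data.Product using (_×_)

record PseudoBCI (a : Level) : Set (suc a) where
  infixr 5 _⇒_ _⇝_
  field
    Carrier : Set a
    _⇒_     : Carrier → Carrier → Carrier
    _⇝_     : Carrier → Carrier → Carrier
    one     : Carrier
    ax1 : ∀ x y z → (x ⇒ y) ⇝ ((y ⇒ z) ⇝ (x ⇒ z)) ≡ one
    ax2 : ∀ x y z → (x ⇝ y) ⇒ ((y ⇝ z) ⇒ (x ⇝ z)) ≡ one
    ax3 : ∀ x → one ⇒ x ≡ x
    ax4 : ∀ x → one ⇝ x ≡ x
    ax5 : ∀ x y → x ⇒ y ≡ one → y ⇒ x ≡ one → x ≡ y

  _≤_ : Carrier → Carrier → Set a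
  x ≤ y = x ⇒ y ≡ one

  IsAtom : Carrier → Set a
  IsAtom e = ∀ x → e ≤ x → x ≡ e

  _⋓₁_ : Carrier → Carrier → Carrier
  x ⋓₁ y = (x ⇒ y) ⇝ y

  _⋓₂_ : Carrier → Carrier → Carrier
  x ⋓₂ y = (x ⇝ y) ⇒ y

  IsTypeISymDerivation : (Carrier → Carrier) → Set a
  IsTypeISymDerivation d =
    (∀ x y → d (x ⇒ y) ≡ (x ⇒ d y) ⋓₂ (y ⇒ d x)) ×
    (∀ x y → d (x ⇝ y) ≡ (x ⇝ d y) ⋓₁ (y ⇝ d x))

-- Setting y = x in the ⇒-rule gives d 1 = (x ⇒ d x) ⋓₂ (x ⇒ d x) = x ⇒ d x, and setting x = 1
-- gives d x = d x ⋓₂ (x ⇒ d 1); by exchange the ⋓₂-closure over x ⇒ d 1 dominates the one over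
-- d 1, so d x is ⋓₂-closed over d 1. When d 1 = 1, an element a with a = (a ⇝ 1) ⇒ 1 is an atom:
-- a ≤ y forces a ⇝ 1 = y ⇝ 1, hence y ≤ (y ⇝ 1) ⇒ 1 = a.
module Submission where

open import Defs
open import Level using (Level)
open import Relation.Binary.PropositionalEquality
  using (_≡_; sym; trans; cong; subst; module ≡-Reasoning)
open import Data.Product using (_×_; _,_; proj₁; proj₂)

module PseudoBCIProperties {a : Level} (A : PseudoBCI a) where
  open PseudoBCI A
  open ≡-Reasoning

  ≤-antisym : ∀ {x y} → x ≤ y → y ≤ x → x ≡ y
  ≤-antisym = ax5 _ _

  x≤x⋓₂y : ∀ x y → x ≤ (x ⋓₂ y)
  x≤x⋓₂y x y with ax2 one x y
  ... | e rewrite ax4 x | ax4 y = e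

  x⇝x⋓₁y≡one : ∀ x y → x ⇝ (x ⋓₁ y) ≡ one
  x⇝x⋓₁y≡one x y with ax1 one x y
  ... | e rewrite ax3 x | ax3 y = e

  ⇝≡one⇒≤ : ∀ {x y} → x ⇝ y ≡ one → x ≤ y
  ⇝≡one⇒≤ {x} {y} h = subst (x ≤_) (trans (cong (_⇒ y) h) (ax3 y)) (x≤x⋓₂y x y)

  ≤⇒⇝≡one : ∀ {x y} → x ≤ y → x ⇝ y ≡ one
  ≤⇒⇝≡one {x} {y} h =
    subst (λ t → x ⇝ t ≡ one) (trans (cong (_⇝ y) h) (ax4 y)) (x⇝x⋓₁y≡one x y)

  x≤x⋓₁y : ∀ x y → x ≤ (x ⋓₁ y)
  x≤x⋓₁y x y = ⇝≡one⇒≤ (x⇝x⋓₁y≡one x y)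

  x⇒x≡one : ∀ x → x ⇒ x ≡ one
  x⇒x≡one x with x≤x⋓₂y one x
  ... | e rewrite ax4 x | ax3 (x ⇒ x) = e

  x⇝x≡one : ∀ x → x ⇝ x ≡ one
  x⇝x≡one x = ≤⇒⇝≡one (x⇒x≡one x)

  x⋓₂x≡x : ∀ x → x ⋓₂ x ≡ x
  x⋓₂x≡x x = trans (cong (_⇒ x) (x⇝x≡one x)) (ax3 x)

  ≤-trans : ∀ {x y z} → x ≤ y → y ≤ z → x ≤ z
  ≤-trans {x} {y} {z} x≤y y≤z with ax1 x y z
  ... | e rewrite x≤y | y≤z | ax4 (one ⇝ (x ⇒ z)) | ax4 (x ⇒ z) = e

  ⇒-antitoneˡ : ∀ {x y} z → x ≤ y → (y ⇒ z) ≤ (x ⇒ z)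
  ⇒-antitoneˡ {x} {y} z x≤y with ax1 x y z
  ... | e rewrite x≤y | ax4 ((y ⇒ z) ⇝ (x ⇒ z)) = ⇝≡one⇒≤ e

  ⇝-antitoneˡ : ∀ {x y} z → x ≤ y → (y ⇝ z) ≤ (x ⇝ z)
  ⇝-antitoneˡ {x} {y} z x≤y with ax2 x y z
  ... | e rewrite ≤⇒⇝≡one x≤y | ax3 ((y ⇝ z) ⇒ (x ⇝ z)) = e

  ≤⇝-swap : ∀ {u v w} → u ≤ (v ⇝ w) → v ≤ (u ⇒ w)
  ≤⇝-swap {v = v} {w} h = ≤-trans (x≤x⋓₂y v w) (⇒-antitoneˡ w h)

  ≤⇒-swap : ∀ {u v w} → v ≤ (u ⇒ w) → u ≤ (v ⇝ w)
  ≤⇒-swap {u} {w = w} h = ≤-trans (x≤x⋓₁y u w) (⇝-antitoneˡ w h)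

  ⇒-prefix : ∀ x y z → (y ⇒ z) ≤ ((x ⇒ y) ⇒ (x ⇒ z))
  ⇒-prefix x y z = ≤⇝-swap (⇝≡one⇒≤ (ax1 x y z))

  ⇝-prefix : ∀ x y z → (y ⇝ z) ≤ ((x ⇝ y) ⇝ (x ⇝ z))
  ⇝-prefix x y z = ≤⇒-swap (ax2 x y z)

  ⇒-⇝-exchange : ∀ x y z → x ⇒ (y ⇝ z) ≡ y ⇝ (x ⇒ z)
  ⇒-⇝-exchange x y z = ≤-antisym
    (≤⇒-swap (≤-trans (x≤x⋓₂y y z) (⇒-prefix x (y ⇝ z) z)))
    (≤⇝-swap (≤-trans (x≤x⋓₁y x z) (⇝-prefix y (x ⇒ z) z)))

  x⇒one≡x⇝one : ∀ x → x ⇒ one ≡ x ⇝ one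
  x⇒one≡x⇝one x = begin
    x ⇒ one         ≡⟨ cong (x ⇒_) (sym (x⇝x≡one x)) ⟩
    x ⇒ (x ⇝ x)     ≡⟨ ⇒-⇝-exchange x x x ⟩
    x ⇝ (x ⇒ x)     ≡⟨ cong (x ⇝_) (x⇒x≡one x) ⟩
    x ⇝ one         ∎

  ≤⇒⇝one≡⇝one : ∀ {x y} → x ≤ y → x ⇝ one ≡ y ⇝ one
  ≤⇒⇝one≡⇝one {x} {y} x≤y =
    ≤-antisym (subst ((x ⇝ one) ≤_) (x⇒one≡x⇝one y) x⇝one≤y⇒one) (⇝-antitoneˡ one x≤y)
    where
    x⇝one≤y⇒one : (x ⇝ one) ≤ (y ⇒ one)
    x⇝one≤y⇒one with ax2 x one y
    ... | e rewrite ax4 y | ≤⇒⇝≡one x≤y = e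

  ⋓₂-closed-one⇒IsAtom : ∀ {e} → e ≡ e ⋓₂ one → IsAtom e
  ⋓₂-closed-one⇒IsAtom {e} e≡e⋓₂one y e≤y = ≤-antisym y≤e e≤y
    where
    y≤e : y ≤ e
    y≤e = subst (y ≤_)
      (trans (cong (_⇒ one) (sym (≤⇒⇝one≡⇝one e≤y))) (sym e≡e⋓₂one))
      (x≤x⋓₂y y one)

  ⋓₂-closed-over-⇒ : ∀ {e} x c → e ≡ e ⋓₂ (x ⇒ c) → e ≡ e ⋓₂ c
  ⋓₂-closed-over-⇒ {e} x c h = ≤-antisym (x≤x⋓₂y e c) e⋓₂c≤e
    where
    e⋓₂c≤e : (e ⋓₂ c) ≤ e
    e⋓₂c≤e = subst ((e ⋓₂ c) ≤_)
      (trans (cong (_⇒ (x ⇒ c)) (⇒-⇝-exchange x e c)) (sym h))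
      (⇒-prefix x (e ⇝ c) c)

  ⋓₁-closed-over-⇝ : ∀ {e} x c → e ≡ e ⋓₁ (x ⇝ c) → e ≡ e ⋓₁ c
  ⋓₁-closed-over-⇝ {e} x c h = ≤-antisym (x≤x⋓₁y e c) e⋓₁c≤e
    where
    e⋓₁c≤e : (e ⋓₁ c) ≤ e
    e⋓₁c≤e = subst ((e ⋓₁ c) ≤_)
      (trans (cong (_⇝ (x ⇝ c)) (sym (⇒-⇝-exchange e x c))) (sym h))
      (⇝-prefix x (e ⇒ c) c)

  module TypeISymDerivation {d : Carrier → Carrier} (isDer : IsTypeISymDerivation d) where

    d-one≡x⇒dx : ∀ x → d one ≡ x ⇒ d x
    d-one≡x⇒dx x = begin
      d one                    ≡⟨ cong d (sym (x⇒x≡one x)) ⟩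
      d (x ⇒ x)                ≡⟨ proj₁ isDer x x ⟩
      (x ⇒ d x) ⋓₂ (x ⇒ d x)   ≡⟨ x⋓₂x≡x (x ⇒ d x) ⟩
      x ⇒ d x                  ∎

    d-one≡x⇝dx : ∀ x → d one ≡ x ⇝ d x
    d-one≡x⇝dx x = begin
      d one                    ≡⟨ cong d (sym (x⇝x≡one x)) ⟩
      d (x ⇝ x)                ≡⟨ proj₂ isDer x x ⟩
      (x ⇝ d x) ⋓₁ (x ⇝ d x)   ≡⟨ cong (_⇝ (x ⇝ d x)) (x⇒x≡one (x ⇝ d x)) ⟩
      one ⇝ (x ⇝ d x)          ≡⟨ ax4 (x ⇝ d x) ⟩
      x ⇝ d x                  ∎

    dx≡dx⋓₂d-one : ∀ x → d x ≡ d x ⋓₂ d one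
    dx≡dx⋓₂d-one x = ⋓₂-closed-over-⇒ x (d one) (begin
      d x                           ≡⟨ cong d (sym (ax3 x)) ⟩
      d (one ⇒ x)                   ≡⟨ proj₁ isDer one x ⟩
      (one ⇒ d x) ⋓₂ (x ⇒ d one)    ≡⟨ cong (_⋓₂ (x ⇒ d one)) (ax3 (d x)) ⟩
      d x ⋓₂ (x ⇒ d one)            ∎)

    dx≡dx⋓₁d-one : ∀ x → d x ≡ d x ⋓₁ d one
    dx≡dx⋓₁d-one x = ⋓₁-closed-over-⇝ x (d one) (begin
      d x                           ≡⟨ cong d (sym (ax4 x)) ⟩
      d (one ⇝ x)                   ≡⟨ proj₂ isDer one x ⟩
      (one ⇝ d x) ⋓₁ (x ⇝ d one)    ≡⟨ cong (_⋓₁ (x ⇝ d one)) (ax4 (d x)) ⟩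
      d x ⋓₁ (x ⇝ d one)            ∎)

    d-one≡one⇒IsAtom-dx : d one ≡ one → ∀ x → IsAtom (d x)
    d-one≡one⇒IsAtom-dx h x =
      ⋓₂-closed-one⇒IsAtom (subst (λ c → d x ≡ d x ⋓₂ c) h (dx≡dx⋓₂d-one x))

proposition5p3 : {a : Level} (A : PseudoBCI a) → let open PseudoBCI A in
    (d : Carrier → Carrier) → IsTypeISymDerivation d →
    (∀ x → (d one ≡ x ⇒ d x) × (d one ≡ x ⇝ d x)) ×
    (∀ x → (d x ≡ d x ⋓₁ d one) × (d x ≡ d x ⋓₂ d one)) ×
    (d one ≡ one →
      (∀ x → x ≤ d x) ×
      (∀ x → IsAtom (d x)) ×
      (∀ x y → (d x ≡ d x ⋓₁ y) × (d x ≡ d x ⋓₂ y)))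
proposition5p3 A d isDer =
  (λ x → d-one≡x⇒dx x , d-one≡x⇝dx x) ,
  (λ x → dx≡dx⋓₁d-one x , dx≡dx⋓₂d-one x) ,
  λ h → (λ x → trans (sym (d-one≡x⇒dx x)) h) ,
        d-one≡one⇒IsAtom-dx h ,
        λ x y → sym (d-one≡one⇒IsAtom-dx h x _ (x≤x⋓₁y (d x) y)) ,
                sym (d-one≡one⇒IsAtom-dx h x _ (x≤x⋓₂y (d x) y))
  where
  open PseudoBCIProperties A
  open TypeISymDerivation isDer
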